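{- Let $b\in\mathbb{Q}$ and let $\phi(z)=z+\frac{b}{z}$. Then $\phi$ has no points in $\mathbb{P}^1(\mathbb{Q})$ of exact period $n$ for any $n\ge 5$.
   Context: A point $P$ has exact period $n$ under $\phi$ if $\phi^n(P)=P$ and $\phi^m(P)\neq P$ for $0<m<n$, where $\phi^n$ denotes the $n$-th iterate. -}

module Defs where

open import Data.Nat using (ℕ; zero; suc; _<_)
open import Data.Rational using (ℚ; 0ℚ; _+_; _÷_; ≢-nonZero)
open import Data.Rational.Properties using (_≟_)
open import Relation.Nullary using (yes; no; ¬_)
open import Relation.Binary.PropositionalEquality using (_≡_)
open import Data.Product using (_×_)

data P1 : Set where
  fin : ℚ → P1
  ∞   : P1

-- φ_b(z) = z + b/z = (z² + b)/z as a self-map of P¹(ℚ).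
-- φ(∞) = ∞; for z ≠ 0, φ(z) = z + b/z; φ(0) = ∞ if b ≠ 0,
-- while for b = 0 the map is the identity z ↦ z, so φ(0) = 0.
φ : ℚ → P1 → P1
φ b ∞ = ∞
φ b (fin z) with z ≟ 0ℚ
... | no z≢0 = fin (z + (b ÷ z) {{≢-nonZero z≢0}})
... | yes _ with b ≟ 0ℚ
...   | yes _ = fin 0ℚ
...   | no _  = ∞

iter : (P1 → P1) → ℕ → P1 → P1
iter f zero    x = x
iter f (suc n) x = f (iter f n x)

HasExactPeriod : (P1 → P1) → ℕ → P1 → Set
HasExactPeriod f n P =
  (0 < n) × (iter f n P ≡ P) × (∀ m → 0 < m → m < n → ¬ (iter f m P ≡ P))

{-# OPTIONS --safe #-}
-- For b ≠ 0 put w = z²/b; then φ_b(z)²/b = (w + 1)²/w. If w = N/D in lowest terms, N + D is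
-- coprime to N·D, so the denominator of the next value is a multiple of |N|·D. Around a cycle the
-- denominators are thus nondecreasing, hence constant, which forces |N| = 1 at every point; then
-- (N + D)² = 1 as well, so w = -1/2, i.e. b = -2z², and φ_b(z) = -z. Hence every periodic point
-- is fixed by φ_b² (for b = 0, φ_b is the identity), and no exact period exceeds 2.
module Submission where

open import Defs
open import Data.Nat using (ℕ; _≤_)
open import Data.Rational using (ℚ)
open import Relation.Nullary using (¬_)

open import Data.Integer as ℤ using (+_; -[1+_]; ∣_∣)
import Data.Integer.Divisibility.Signed as ℤ
import Data.Integer.Properties as ℤ
open import Data.Integer.Tactic.RingSolver using () renaming (solve-∀ to ℤ-solve-∀)
open import Data.Nat as ℕ using (zero; suc; _<_; z≤n; s≤s; _∸_; NonZero)
open import Data.Nat.Coprimality as Coprime using (Coprime; coprime-divisor)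
open import Data.Nat.Divisibility as ℕ using (_∣_; ∣⇒≤; n∣m*n; ∣-trans; 0∣⇒≡0)
import Data.Nat.Properties as ℕ
open import Data.Product using (_,_)
open import Data.Rational.Solver using (module +-*-Solver)
open import Data.Rational as ℚ using (_+_; _*_; -_; -½; mkℚ; ↥_; ↧_; ↧ₙ_; 0ℚ; 1ℚ; _÷_; 1/_; ≢-nonZero)
import Data.Rational.Properties as ℚ
import Data.Rational.Unnormalised as ℚᵘ
import Data.Rational.Unnormalised.Properties as ℚᵘ
open import Data.Sum using (inj₁; inj₂)
open import Relation.Binary.PropositionalEquality
open import Relation.Nullary using (yes; no; contradiction)

record _↦ψ_ (w w' : ℚ) : Set where
  constructor step
  field equation : w' * w ≡ (w + 1ℚ) * (w + 1ℚ)

↦ψ-toℚᵘ : ∀ {w w'} → w ↦ψ w' →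
  ℚ.toℚᵘ w' ℚᵘ.* ℚ.toℚᵘ w ℚᵘ.≃ (ℚ.toℚᵘ w ℚᵘ.+ ℚᵘ.1ℚᵘ) ℚᵘ.* (ℚ.toℚᵘ w ℚᵘ.+ ℚᵘ.1ℚᵘ)
↦ψ-toℚᵘ {w} {w'} (step eq) = begin
  ℚ.toℚᵘ w' ℚᵘ.* ℚ.toℚᵘ w                 ≈⟨ ℚ.toℚᵘ-homo-* w' w ⟨
  ℚ.toℚᵘ (w' * w)                         ≈⟨ ℚ.toℚᵘ-cong eq ⟩
  ℚ.toℚᵘ ((w + 1ℚ) * (w + 1ℚ))            ≈⟨ ℚ.toℚᵘ-homo-* (w + 1ℚ) (w + 1ℚ) ⟩
  ℚ.toℚᵘ (w + 1ℚ) ℚᵘ.* ℚ.toℚᵘ (w + 1ℚ)    ≈⟨ ℚᵘ.*-cong (ℚ.toℚᵘ-homo-+ w 1ℚ) (ℚ.toℚᵘ-homo-+ w 1ℚ) ⟩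
  (ℚ.toℚᵘ w ℚᵘ.+ ℚᵘ.1ℚᵘ) ℚᵘ.* (ℚ.toℚᵘ w ℚᵘ.+ ℚᵘ.1ℚᵘ) ∎
  where open ℚᵘ.≃-Reasoning

↦ψ-cross-multiplied : ∀ {w w'} → w ↦ψ w' →
  ↥ w' ℤ.* ↥ w ℤ.* ↧ w ≡ (↥ w ℤ.+ ↧ w) ℤ.* (↥ w ℤ.+ ↧ w) ℤ.* ↧ w'
↦ψ-cross-multiplied {w@(mkℚ _ _ _)} {w'@(mkℚ _ _ _)} eq = ℤ.*-cancelʳ-≡ _ _ (↧ w) (begin
  ↥ w' ℤ.* ↥ w ℤ.* ↧ w ℤ.* ↧ w
    ≡⟨ regroupˡ (↥ w') (↥ w) (↧ w) ⟩
  ↥ w' ℤ.* ↥ w ℤ.* ((↧ w ℤ.* + 1) ℤ.* (↧ w ℤ.* + 1))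
    ≡⟨ ℚᵘ.drop-*≡* (↦ψ-toℚᵘ eq) ⟩
  (↥ w ℤ.* + 1 ℤ.+ + 1 ℤ.* ↧ w) ℤ.* (↥ w ℤ.* + 1 ℤ.+ + 1 ℤ.* ↧ w) ℤ.* (↧ w' ℤ.* ↧ w)
    ≡⟨ regroupʳ (↥ w) (↧ w) (↧ w') ⟩
  (↥ w ℤ.+ ↧ w) ℤ.* (↥ w ℤ.+ ↧ w) ℤ.* ↧ w' ℤ.* ↧ w ∎)
  where
  open ≡-Reasoning
  regroupˡ : ∀ a b x → a ℤ.* b ℤ.* x ℤ.* x ≡ a ℤ.* b ℤ.* ((x ℤ.* + 1) ℤ.* (x ℤ.* + 1))
  regroupˡ = ℤ-solve-∀
  regroupʳ : ∀ a x y → (a ℤ.* + 1 ℤ.+ + 1 ℤ.* x) ℤ.* (a ℤ.* + 1 ℤ.+ + 1 ℤ.* x) ℤ.* (y ℤ.* x)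
                     ≡ (a ℤ.+ x) ℤ.* (a ℤ.+ x) ℤ.* y ℤ.* x
  regroupʳ = ℤ-solve-∀

↦ψ-cross-multiplied-∣∣ : ∀ {w w'} → w ↦ψ w' →
  ∣ ↥ w' ∣ ℕ.* (∣ ↥ w ∣ ℕ.* ↧ₙ w) ≡ ∣ ↥ w ℤ.+ ↧ w ∣ ℕ.* ∣ ↥ w ℤ.+ ↧ w ∣ ℕ.* ↧ₙ w'
↦ψ-cross-multiplied-∣∣ {w} {w'} eq = begin
  ∣ ↥ w' ∣ ℕ.* (∣ ↥ w ∣ ℕ.* ↧ₙ w)
    ≡⟨ ℕ.*-assoc ∣ ↥ w' ∣ _ _ ⟨
  ∣ ↥ w' ∣ ℕ.* ∣ ↥ w ∣ ℕ.* ↧ₙ w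
    ≡⟨ cong (ℕ._* ↧ₙ w) (ℤ.abs-* (↥ w') (↥ w)) ⟨
  ∣ ↥ w' ℤ.* ↥ w ∣ ℕ.* ↧ₙ w
    ≡⟨ ℤ.abs-* (↥ w' ℤ.* ↥ w) (↧ w) ⟨
  ∣ ↥ w' ℤ.* ↥ w ℤ.* ↧ w ∣
    ≡⟨ cong ∣_∣ (↦ψ-cross-multiplied eq) ⟩
  ∣ (↥ w ℤ.+ ↧ w) ℤ.* (↥ w ℤ.+ ↧ w) ℤ.* ↧ w' ∣
    ≡⟨ ℤ.abs-* ((↥ w ℤ.+ ↧ w) ℤ.* (↥ w ℤ.+ ↧ w)) (↧ w') ⟩
  ∣ (↥ w ℤ.+ ↧ w) ℤ.* (↥ w ℤ.+ ↧ w) ∣ ℕ.* ↧ₙ w'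
    ≡⟨ cong (ℕ._* ↧ₙ w') (ℤ.abs-* (↥ w ℤ.+ ↧ w) (↥ w ℤ.+ ↧ w)) ⟩
  ∣ ↥ w ℤ.+ ↧ w ∣ ℕ.* ∣ ↥ w ℤ.+ ↧ w ∣ ℕ.* ↧ₙ w' ∎
  where open ≡-Reasoning

coprime-* : ∀ {a b c} → Coprime a b → Coprime a c → Coprime a (b ℕ.* c)
coprime-* a⊥b a⊥c (d∣a , d∣bc) =
  a⊥c (d∣a , coprime-divisor (λ (d∣d' , d'∣b) → a⊥b (∣-trans d∣d' d∣a , d'∣b)) d∣bc)

coprime-numerator+denominator : ∀ w → Coprime ∣ ↥ w ℤ.+ ↧ w ∣ (∣ ↥ w ∣ ℕ.* ↧ₙ w)
coprime-numerator+denominator w@(mkℚ _ _ N⊥D′) = coprime-* ⊥numerator ⊥denominator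
  where
  N⊥D : Coprime ∣ ↥ w ∣ (↧ₙ w)
  N⊥D = Coprime.recompute N⊥D′
  ⊥numerator : Coprime ∣ ↥ w ℤ.+ ↧ w ∣ ∣ ↥ w ∣
  ⊥numerator {d} (d∣N+D , d∣N) =
    N⊥D (d∣N , ℤ.∣⇒∣ᵤ (ℤ.∣m+n∣m⇒∣n (ℤ.∣ᵤ⇒∣ {+ d} {↥ w ℤ.+ ↧ w} d∣N+D) (ℤ.∣ᵤ⇒∣ {+ d} {↥ w} d∣N)))
  ⊥denominator : Coprime ∣ ↥ w ℤ.+ ↧ w ∣ (↧ₙ w)
  ⊥denominator {d} (d∣N+D , d∣D) =
    N⊥D (ℤ.∣⇒∣ᵤ {+ d} {↥ w} (ℤ.∣m+n∣n⇒∣m (ℤ.∣ᵤ⇒∣ {+ d} {↥ w ℤ.+ ↧ w} d∣N+D) (ℤ.∣ᵤ⇒∣ {+ d} {↧ w} d∣D)) , d∣D)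

↦ψ-denominator : ∀ {w w'} → w ↦ψ w' → ∣ ↥ w ∣ ℕ.* ↧ₙ w ∣ ↧ₙ w'
↦ψ-denominator {w} {w'} eq =
  coprime-divisor (coprime-* ⊥N+D ⊥N+D) (ℕ.divides ∣ ↥ w' ∣ (sym (↦ψ-cross-multiplied-∣∣ eq)))
  where
  ⊥N+D : Coprime (∣ ↥ w ∣ ℕ.* ↧ₙ w) ∣ ↥ w ℤ.+ ↧ w ∣
  ⊥N+D = Coprime.sym (coprime-numerator+denominator w)

-½-characterisation : ∀ w → ∣ ↥ w ∣ ≡ 1 → ∣ ↥ w ℤ.+ ↧ w ∣ ≡ 1 → w ≡ -½
-½-characterisation (mkℚ (+ _) _ _) refl ()
-½-characterisation (mkℚ -[1+ 0 ] 1 _) refl refl = refl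
-½-characterisation (mkℚ -[1+ 0 ] (suc (suc _)) _) refl ()

↦ψ-unit-numerators⇒-½ : ∀ {w w'} → w ↦ψ w' → ∣ ↥ w ∣ ≡ 1 → ∣ ↥ w' ∣ ≡ 1 → ↧ₙ w ≡ ↧ₙ w' → w ≡ -½
↦ψ-unit-numerators⇒-½ {w} {w'} eq N≡1 N'≡1 D≡D' =
  -½-characterisation w N≡1 (ℕ.m*n≡1⇒m≡1 m m (ℕ.*-cancelʳ-≡ (m ℕ.* m) 1 (↧ₙ w) (sym cross)))
  where
  m : ℕ
  m = ∣ ↥ w ℤ.+ ↧ w ∣
  cross : 1 ℕ.* ↧ₙ w ≡ m ℕ.* m ℕ.* ↧ₙ w
  cross = begin
    1 ℕ.* ↧ₙ w                        ≡⟨ cong (1 ℕ.*_) (ℕ.*-identityˡ (↧ₙ w)) ⟨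
    1 ℕ.* (1 ℕ.* ↧ₙ w)                ≡⟨ cong₂ (λ a b → a ℕ.* (b ℕ.* ↧ₙ w)) N'≡1 N≡1 ⟨
    ∣ ↥ w' ∣ ℕ.* (∣ ↥ w ∣ ℕ.* ↧ₙ w)   ≡⟨ ↦ψ-cross-multiplied-∣∣ eq ⟩
    m ℕ.* m ℕ.* ↧ₙ w'                ≡⟨ cong (m ℕ.* m ℕ.*_) D≡D' ⟨
    m ℕ.* m ℕ.* ↧ₙ w                 ∎
    where open ≡-Reasoning

m*n∣o⇒o≤n⇒m≡1 : ∀ m {n o} .{{_ : NonZero o}} → m ℕ.* n ∣ o → o ≤ n → m ≡ 1
m*n∣o⇒o≤n⇒m≡1 m {n} {o} m*n∣o o≤n = ℕ.≤-antisym m≤1 (ℕ.n≢0⇒n>0 m≢0)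
  where
  instance
    n≢0 : NonZero n
    n≢0 = ℕ.>-nonZero (ℕ.<-≤-trans (ℕ.>-nonZero⁻¹ o) o≤n)
  m≤1 : m ≤ 1
  m≤1 = ℕ.*-cancelʳ-≤ m 1 n (ℕ.≤-trans (∣⇒≤ m*n∣o) (ℕ.≤-trans o≤n (ℕ.≤-reflexive (sym (ℕ.*-identityˡ n)))))
  m≢0 : m ≢ 0
  m≢0 refl = ℕ.≢-nonZero⁻¹ o (0∣⇒≡0 m*n∣o)

Nondecreasing : (ℕ → ℕ) → ℕ → Set
Nondecreasing f n = ∀ k → k < n → f k ≤ f (suc k)

nondecreasing-mono : ∀ {f n i j} → Nondecreasing f n → i ≤ j → j ≤ n → f i ≤ f j
nondecreasing-mono {j = zero} _ z≤n _ = ℕ.≤-refl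
nondecreasing-mono {j = suc j} up i≤1+j 1+j≤n with ℕ.m≤n⇒m<n∨m≡n i≤1+j
... | inj₁ (s≤s i≤j) = ℕ.≤-trans (nondecreasing-mono up i≤j (ℕ.<⇒≤ 1+j≤n)) (up j 1+j≤n)
... | inj₂ refl = ℕ.≤-refl

nondecreasing-cycle⇒nonincreasing : ∀ {f n} → Nondecreasing f n → f n ≤ f 0 → ∀ k → k < n → f (suc k) ≤ f k
nondecreasing-cycle⇒nonincreasing {f} {n} up fn≤f0 k k<n = begin
  f (suc k) ≤⟨ nondecreasing-mono up k<n ℕ.≤-refl ⟩
  f n       ≤⟨ fn≤f0 ⟩
  f 0       ≤⟨ nondecreasing-mono up z≤n (ℕ.<⇒≤ k<n) ⟩
  f k       ∎
  where open ℕ.≤-Reasoning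

ψ-semiconjugacy : ∀ {b c z u} → b * c ≡ 1ℚ → z * u ≡ 1ℚ →
  (z * z * c) ↦ψ ((z + b * u) * (z + b * u) * c)
ψ-semiconjugacy {b} {c} {z} {u} bc≡1 zu≡1 = step (begin
  (z + b * u) * (z + b * u) * c * (z * z * c)
    ≡⟨ expand z b c u ⟩
  c * c * (z * z + b * (z * u)) * (z * z + b * (z * u))
    ≡⟨ cong (λ t → c * c * (z * z + b * t) * (z * z + b * t)) zu≡1 ⟩
  c * c * (z * z + b * 1ℚ) * (z * z + b * 1ℚ)
    ≡⟨ regroup z b c ⟩
  (z * z * c + b * c) * (z * z * c + b * c)
    ≡⟨ cong (λ t → (z * z * c + t) * (z * z * c + t)) bc≡1 ⟩
  (z * z * c + 1ℚ) * (z * z * c + 1ℚ) ∎)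
  where
  open ≡-Reasoning
  open +-*-Solver using (solve; _:=_; _:+_; _:*_; :-_; con)
  expand : ∀ z b c u → (z + b * u) * (z + b * u) * c * (z * z * c)
    ≡ c * c * (z * z + b * (z * u)) * (z * z + b * (z * u))
  expand = solve 4 (λ z b c u → (z :+ b :* u) :* (z :+ b :* u) :* c :* (z :* z :* c)
    := c :* c :* (z :* z :+ b :* (z :* u)) :* (z :* z :+ b :* (z :* u))) refl
  regroup : ∀ z b c → c * c * (z * z + b * 1ℚ) * (z * z + b * 1ℚ)
    ≡ (z * z * c + b * c) * (z * z * c + b * c)
  regroup = solve 3 (λ z b c → c :* c :* (z :* z :+ b :* con 1ℚ) :* (z :* z :+ b :* con 1ℚ)
    := (z :* z :* c :+ b :* c) :* (z :* z :* c :+ b :* c)) refl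

z²c≡-½⇒z+bu≡-z : ∀ {b c z u} → b * c ≡ 1ℚ → z * u ≡ 1ℚ → z * z * c ≡ -½ →
  z + b * u ≡ - z
z²c≡-½⇒z+bu≡-z {b} {c} {z} {u} bc≡1 zu≡1 w≡-½ = begin
  z + b * u                               ≡⟨ cong (λ t → z + t * u) b≡-2z² ⟩
  z + - (z * z + z * z) * u               ≡⟨ distribute z u ⟩
  z + - (z * (z * u)) + - (z * (z * u))   ≡⟨ cong (λ t → z + - (z * t) + - (z * t)) zu≡1 ⟩
  z + - (z * 1ℚ) + - (z * 1ℚ)             ≡⟨ cancel z ⟩
  - z                                     ∎
  where
  open ≡-Reasoning
  open +-*-Solver using (solve; _:=_; _:+_; _:*_; :-_; con)
  factor : ∀ z b c → - (z * z * c + z * z * c) * b ≡ - (z * z + z * z) * (b * c)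
  factor = solve 3 (λ z b c → (:- (z :* z :* c :+ z :* z :* c)) :* b
    := (:- (z :* z :+ z :* z)) :* (b :* c)) refl
  b≡-2z² : b ≡ - (z * z + z * z)
  b≡-2z² = begin
    b                               ≡⟨ ℚ.*-identityˡ b ⟨
    1ℚ * b                          ≡⟨⟩
    - (-½ + -½) * b                 ≡⟨ cong (λ t → - (t + t) * b) w≡-½ ⟨
    - (z * z * c + z * z * c) * b   ≡⟨ factor z b c ⟩
    - (z * z + z * z) * (b * c)     ≡⟨ cong (- (z * z + z * z) *_) bc≡1 ⟩
    - (z * z + z * z) * 1ℚ          ≡⟨ ℚ.*-identityʳ _ ⟩
    - (z * z + z * z)               ∎
  distribute : ∀ z u → z + - (z * z + z * z) * u ≡ z + - (z * (z * u)) + - (z * (z * u))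
  distribute = solve 2 (λ z u → z :+ (:- (z :* z :+ z :* z)) :* u
    := z :+ (:- (z :* (z :* u))) :+ (:- (z :* (z :* u)))) refl
  cancel : ∀ z → z + - (z * 1ℚ) + - (z * 1ℚ) ≡ - z
  cancel = solve 1 (λ z → z :+ (:- (z :* con 1ℚ)) :+ (:- (z :* con 1ℚ)) := :- z) refl

φ-nonzero : ∀ b {z} (z≢0 : z ≢ 0ℚ) → φ b (fin z) ≡ fin (z + (b ÷ z) {{≢-nonZero z≢0}})
φ-nonzero b {z} z≢0 with z ℚ.≟ 0ℚ
... | yes z≡0 = contradiction z≡0 z≢0
... | no _ = refl

φ-zero : ∀ {b} → b ≢ 0ℚ → φ b (fin 0ℚ) ≡ ∞
φ-zero {b} b≢0 with b ℚ.≟ 0ℚ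
... | yes b≡0 = contradiction b≡0 b≢0
... | no _ = refl

φ-0ℚ≗id : ∀ P → φ 0ℚ P ≡ P
φ-0ℚ≗id ∞ = refl
φ-0ℚ≗id (fin z) with z ℚ.≟ 0ℚ
... | yes z≡0 = cong fin (sym z≡0)
... | no z≢0 = cong fin (trans (cong (λ t → z + t) (ℚ.*-zeroˡ ((1/ z) {{≢-nonZero z≢0}}))) (ℚ.+-identityʳ z))

φ-negates : ∀ {b c z} → b * c ≡ 1ℚ → (z≢0 : z ≢ 0ℚ) → z * z * c ≡ -½ → φ b (fin z) ≡ fin (- z)
φ-negates {b} {z = z} bc≡1 z≢0 w≡-½ =
  trans (φ-nonzero b z≢0) (cong fin (z²c≡-½⇒z+bu≡-z {b} bc≡1 (ℚ.*-inverseʳ z {{≢-nonZero z≢0}}) w≡-½))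

φ²-fixes : ∀ {b c z} → b * c ≡ 1ℚ → z ≢ 0ℚ → z * z * c ≡ -½ → iter (φ b) 2 (fin z) ≡ fin z
φ²-fixes {b} {c} {z} bc≡1 z≢0 w≡-½ = begin
  φ b (φ b (fin z))  ≡⟨ cong (φ b) (φ-negates bc≡1 z≢0 w≡-½) ⟩
  φ b (fin (- z))    ≡⟨ φ-negates bc≡1 -z≢0 (trans (neg-square z c) w≡-½) ⟩
  fin (- - z)        ≡⟨ cong fin (neg-involutive z) ⟩
  fin z              ∎
  where
  open ≡-Reasoning
  open +-*-Solver using (solve; _:=_; _:+_; _:*_; :-_; con)
  -z≢0 : - z ≢ 0ℚ
  -z≢0 -z≡0 = z≢0 (ℚ.neg-injective -z≡0)
  neg-square : ∀ z c → - z * - z * c ≡ z * z * c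
  neg-square = solve 2 (λ z c → (:- z) :* (:- z) :* c := z :* z :* c) refl
  neg-involutive : ∀ z → - - z ≡ z
  neg-involutive = solve 1 (λ z → :- (:- z) := z) refl

iter-+ : ∀ (f : P1 → P1) m k P → iter f (m ℕ.+ k) P ≡ iter f m (iter f k P)
iter-+ f zero k P = refl
iter-+ f (suc m) k P = cong f (iter-+ f m k P)

iter-fixed : ∀ {f : P1 → P1} {Q} → f Q ≡ Q → ∀ k → iter f k Q ≡ Q
iter-fixed fQ≡Q zero = refl
iter-fixed {f} fQ≡Q (suc k) = trans (cong f (iter-fixed fQ≡Q k)) fQ≡Q

periodic-orbit-avoids-fixed : ∀ {f : P1 → P1} {Q P n} → f Q ≡ Q → iter f n P ≡ P → P ≢ Q →
  ∀ k → k ≤ n → iter f k P ≢ Q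
periodic-orbit-avoids-fixed {f} {Q} {P} {n} fQ≡Q periodic P≢Q k k≤n hit = P≢Q (begin
  P                              ≡⟨ periodic ⟨
  iter f n P                     ≡⟨ cong (λ m → iter f m P) (ℕ.m∸n+n≡m k≤n) ⟨
  iter f (n ∸ k ℕ.+ k) P         ≡⟨ iter-+ f (n ∸ k) k P ⟩
  iter f (n ∸ k) (iter f k P)    ≡⟨ cong (iter f (n ∸ k)) hit ⟩
  iter f (n ∸ k) Q               ≡⟨ iter-fixed fQ≡Q (n ∸ k) ⟩
  Q                              ∎)
  where open ≡-Reasoning

module PeriodicOrbit {b : ℚ} (b≢0 : b ≢ 0ℚ) {n : ℕ} {z₀ : ℚ}
                     (periodic : iter (φ b) n (fin z₀) ≡ fin z₀) where

  instance
    b-nonZero : ℚ.NonZero b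
    b-nonZero = ≢-nonZero b≢0

  b*1/b≡1 : b * 1/ b ≡ 1ℚ
  b*1/b≡1 = ℚ.*-inverseʳ b

  orbit : ℕ → P1
  orbit k = iter (φ b) k (fin z₀)

  -- The orbit never reaches ∞, so the value at ∞ is irrelevant.
  w : P1 → ℚ
  w (fin z) = z * z * 1/ b
  w ∞       = 0ℚ

  orbit-finite : ∀ k → k ≤ n → orbit k ≢ ∞
  orbit-finite = periodic-orbit-avoids-fixed refl periodic (λ ())

  w-↦ψ : ∀ {z} → z ≢ 0ℚ → w (fin z) ↦ψ w (φ b (fin z))
  w-↦ψ {z} z≢0 = subst (λ Q → w (fin z) ↦ψ w Q) (sym (φ-nonzero b z≢0))
    (ψ-semiconjugacy {b} {1/ b} {z} b*1/b≡1 (ℚ.*-inverseʳ z {{≢-nonZero z≢0}}))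

  orbit-↦ψ : ∀ k → k < n → w (orbit k) ↦ψ w (orbit (suc k))
  orbit-↦ψ k k<n with orbit k | orbit-finite k (ℕ.<⇒≤ k<n) | orbit-finite (suc k) k<n
  ... | ∞     | finite | _           = contradiction refl finite
  ... | fin z | _      | next-finite = w-↦ψ {z} λ { refl → next-finite (φ-zero b≢0) }

  denominator : ℕ → ℕ
  denominator k = ↧ₙ w (orbit k)

  denominator-nondecreasing : Nondecreasing denominator n
  denominator-nondecreasing k k<n = ∣⇒≤ (∣-trans (n∣m*n ∣ ↥ w (orbit k) ∣) (↦ψ-denominator (orbit-↦ψ k k<n)))

  denominator-nonincreasing : ∀ k → k < n → denominator (suc k) ≤ denominator k
  denominator-nonincreasing = nondecreasing-cycle⇒nonincreasing denominator-nondecreasing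
    (ℕ.≤-reflexive (cong (λ Q → ↧ₙ w Q) periodic))

  numerator-unit : ∀ k → k < n → ∣ ↥ w (orbit k) ∣ ≡ 1
  numerator-unit k k<n =
    m*n∣o⇒o≤n⇒m≡1 _ (↦ψ-denominator (orbit-↦ψ k k<n)) (denominator-nonincreasing k k<n)

  w₀≡-½ : 1 < n → w (fin z₀) ≡ -½
  w₀≡-½ 1<n = ↦ψ-unit-numerators⇒-½ (orbit-↦ψ 0 0<n) (numerator-unit 0 0<n) (numerator-unit 1 1<n)
    (ℕ.≤-antisym (denominator-nondecreasing 0 0<n) (denominator-nonincreasing 0 0<n))
    where
    0<n : 0 < n
    0<n = ℕ.<-trans ℕ.z<s 1<n

  φ²-fixes-z₀ : 1 < n → iter (φ b) 2 (fin z₀) ≡ fin z₀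
  φ²-fixes-z₀ 1<n = φ²-fixes b*1/b≡1 z₀≢0 (w₀≡-½ 1<n)
    where
    z₀≢0 : z₀ ≢ 0ℚ
    z₀≢0 refl = orbit-finite 1 (ℕ.<⇒≤ 1<n) (φ-zero b≢0)

periodic⇒φ²-fixed : ∀ b {n} → 0 < n → ∀ P → iter (φ b) n P ≡ P → iter (φ b) 2 P ≡ P
periodic⇒φ²-fixed b _ ∞ _ = refl
periodic⇒φ²-fixed b {1} _ P periodic = trans (cong (φ b) periodic) periodic
periodic⇒φ²-fixed b {n@(suc (suc _))} _ (fin z) periodic with b ℚ.≟ 0ℚ
... | yes refl = trans (cong (φ 0ℚ) (φ-0ℚ≗id (fin z))) (φ-0ℚ≗id (fin z))
... | no b≢0   = PeriodicOrbit.φ²-fixes-z₀ b≢0 {n} periodic (s≤s (s≤s z≤n))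

theorem4p1 : (b : ℚ) → (n : ℕ) → 5 ≤ n → (P : P1) → ¬ HasExactPeriod (φ b) n P
theorem4p1 b n 5≤n P (0<n , periodic , minimal) =
  minimal 2 (s≤s z≤n) (ℕ.≤-trans (s≤s (s≤s (s≤s z≤n))) 5≤n) (periodic⇒φ²-fixed b 0<n P periodic)
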